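{- Let $G=(V,E)$ be a strongly connected digraph that has a good decomposition $C_1,\dots,C_N$ with witness set $F$ and in which every vertex has indegree at most $2$ and outdegree at most $2$; let $G^{new}=(V^{new},E^{new})$ be obtained by the splitting operation. Then for every integer $t\ge0$, every $S\subseteq E^{new}$ with $|S|\le t+1$, every $Q\subseteq F$ with $|Q|\le|F|-(t+3)$, and every $h\in F-Q$, $$z^{Q,t+1}_S=\frac{t+2}{t+3}\,z^{Q\cup\{h\},t}_S+\frac{1}{t+3}\,\mathbf{1}[S\subseteq \mathrm{tour}(h)].$$
   Context: Good decomposition: a strongly connected digraph $G=(V,E)$ has a good decomposition with witness set $F$ if $E$ is partitioned into edge-disjoint dicycles $C_1,\dots,C_N$, and $F$ is a nonempty subset of $\{1,\dots,N\}$ such that $G-E(C_j)$ is strongly connected for every $j\in F$. Splitting operation: for each vertex $v$ of $G$ with indegree $=$ outdegree $=2$, exactly two of the dicycles pass through $v$; label them $C_i,C_j$ (in a fixed but arbitrary way) and let $e_{i1}=(a,v),e_{i2}=(v,b)$ be the edges of $C_i$ at $v$ and $e_{j1}=(c,v),e_{j2}=(v,d)$ those of $C_j$. Replace $v$ by two new vertices $v^u,v^b$; replace $e_{i1}$ by $(a,v^u)$, $e_{j2}$ by $(v^u,d)$, $e_{i2}$ by $(v^b,b)$, $e_{j1}$ by $(c,v^b)$ (solid edges), and add the dashed edges $(v^b,v^u)$ and $(v^u,v^b)$. Doing this at all such vertices gives $G^{new}$. Let $D$ be the set of dashed edges. For each $j$, $E(C_j)$ also denotes the set of images in $G^{new}$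 of the edges of $C_j$, and $D(C_j)$ is the set consisting of, for each split vertex $v$ on $C_j$, the dashed edge at $\{v^u,v^b\}$ whose head equals the head of the image of the edge of $C_j$ entering $v$. For $j\in F$, $\mathrm{tour}(j)=D(C_j)\cup\bigcup_{i\ne j}E(C_i)$. The vectors $z^{Q,t}$ (for $Q\subseteq F$, $t\ge0$): for $S\subseteq E^{new}$ with $|S|\le t+1$, let $g_Q(S)$ be the number of $j\in F-Q$ with $E(C_j)\cap S\ne\emptyset$. Then $z^{Q,t}_S=\frac{t+2-g_Q(S)}{t+2}$ if $S\cap D=\emptyset$; $z^{Q,t}_S=\frac{1}{t+2}$ if $S\cap D\ne\emptyset$ and $S\subseteq\mathrm{tour}(i)$ for some $i\in F-Q$; $z^{Q,t}_S=0$ otherwise. $\mathbf{1}[\cdot]$ is $1$ if the condition holds and $0$ otherwise. -}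

module Defs where

open import Data.Nat as ℕ using (ℕ; zero; suc; _≤_; _+_)
open import Data.Nat.DivMod using (_mod_)
open import Data.Bool using (Bool; true; false; not; _∧_; _∨_; if_then_else_; T)
open import Data.Fin as Fin using (Fin; toℕ)
open import Data.Fin.Subset using (Subset)
open import Data.Vec using (lookup)
open import Data.List using (List; length; filterᵇ; allFin)
open import Data.Bool.ListAction using (any; all)
open import Data.Product using (Σ; _×_; _,_)
open import Data.Integer as ℤ using (ℤ; +_)
open import Data.Rational using (ℚ; _/_; 0ℚ)
open import Relation.Nullary using (¬_; does)
open import Relation.Binary.PropositionalEquality using (_≡_; _≢_)

_=ᶠ_ : ∀ {k} → Fin k → Fin k → Bool
i =ᶠ j = does (i Fin.≟ j)

record Digraph : Set where
  field
    n m : ℕ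
    src tgt : Fin m → Fin n
open Digraph public

Simple : Digraph → Set
Simple G = (∀ e → src G e ≢ tgt G e)
         × (∀ e e' → src G e ≡ src G e' → tgt G e ≡ tgt G e' → e ≡ e')

data Reach (G : Digraph) (P : Fin (m G) → Set) : Fin (n G) → Fin (n G) → Set where
  here : ∀ {v} → Reach G P v v
  step : ∀ {u v} (e : Fin (m G)) → P e → src G e ≡ u →
         Reach G P (tgt G e) v → Reach G P u v

StronglyConnectedOn : (G : Digraph) → (Fin (m G) → Set) → Set
StronglyConnectedOn G P = ∀ u v → Reach G P u v

record ⊤' : Set where

StronglyConnected : Digraph → Set
StronglyConnected G = StronglyConnectedOn G (λ _ → ⊤')

indeg outdeg : (G : Digraph) → Fin (n G) → ℕ
indeg  G v = length (filterᵇ (λ e → tgt G e =ᶠ v) (allFin (m G)))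
outdeg G v = length (filterᵇ (λ e → src G e =ᶠ v) (allFin (m G)))

-- A family of dicycles C_0 … C_{N-1}; cycle j is the closed sequence of arcs
-- cyc j 0, cyc j 1, …, cyc j len_j ; cycOf e = index of the cycle containing e.

record CycleFamily (G : Digraph) : Set where
  field
    N     : ℕ
    len   : Fin N → ℕ
    cyc   : (j : Fin N) → Fin (suc (len j)) → Fin (m G)
    cycOf : Fin (m G) → Fin N
open CycleFamily public

cnext : ∀ {k} → Fin (suc k) → Fin (suc k)
cnext {k} i = suc (toℕ i) mod (suc k)

OnCycle : ∀ {G} (C : CycleFamily G) → Fin (N C) → Fin (m G) → Set
OnCycle C j e = Σ (Fin (suc (len C j))) λ i → cyc C j i ≡ e

IsDicycle : ∀ {G} (C : CycleFamily G) → Fin (N C) → Set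
IsDicycle {G} C j =
    (∀ i → tgt G (cyc C j i) ≡ src G (cyc C j (cnext i)))
  × (∀ i i' → src G (cyc C j i) ≡ src G (cyc C j i') → i ≡ i')

IsDecomposition : ∀ {G} (C : CycleFamily G) → Set
IsDecomposition {G} C =
    (∀ j → IsDicycle C j)
  × (∀ e → OnCycle C (cycOf C e) e)
  × (∀ j i → cycOf C (cyc C j i) ≡ j)

IsGoodDecomposition : ∀ {G} (C : CycleFamily G) → Subset (N C) → Set
IsGoodDecomposition {G} C F =
    IsDecomposition C
  × Data.Fin.Subset.Nonempty F
  × (∀ j → j Data.Fin.Subset.∈ F → StronglyConnectedOn G (λ e → ¬ OnCycle C j e))
  where import Data.Fin.Subset

isSplit : (G : Digraph) → Fin (n G) → Bool
isSplit G v = (indeg G v ℕ.≡ᵇ 2) ∧ (outdeg G v ℕ.≡ᵇ 2)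

-- A labelling chooses, at each split vertex v, which of the two dicycles
-- through v is called C_i (lab v); the other one is C_j.
ValidLabelling : ∀ {G} (C : CycleFamily G) → (Fin (n G) → Fin (N C)) → Set
ValidLabelling {G} C lab =
  ∀ v → T (isSplit G v) → Σ (Fin (m G)) λ e → (tgt G e ≡ v) × (cycOf C e ≡ lab v)

-- vertices of G^new: old v (v not split), up v = v^u, bot v = v^b (v split)
data NewV (k : ℕ) : Set where
  old up bot : Fin k → NewV k

_=ⱽ_ : ∀ {k} → NewV k → NewV k → Bool
old x =ⱽ old y = x =ᶠ y
up  x =ⱽ up  y = x =ᶠ y
bot x =ⱽ bot y = x =ᶠ y
_ =ⱽ _ = false

-- arcs of G^new: the image of an original arc e, or a dashed arc at split v
-- (dashed v _ true = (v^b , v^u), dashed v _ false = (v^u , v^b))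
data NewE (G : Digraph) : Set where
  solid  : Fin (m G) → NewE G
  dashed : (v : Fin (n G)) → T (isSplit G v) → Bool → NewE G

isDashed : ∀ {G} → NewE G → Bool
isDashed (solid _)      = false
isDashed (dashed _ _ _) = true

module Split {G : Digraph} (C : CycleFamily G) (lab : Fin (n G) → Fin (N C)) where

  -- tail of image of e: at split w, e_{i2} ↦ (w^b,·), e_{j2} ↦ (w^u,·)
  newTail : NewE G → NewV (n G)
  newTail (solid e) with isSplit G (src G e)
  ... | true  = if cycOf C e =ᶠ lab (src G e) then bot (src G e) else up (src G e)
  ... | false = old (src G e)
  newTail (dashed v _ true)  = bot v
  newTail (dashed v _ false) = up v

  -- head of image of e: at split v, e_{i1} ↦ (·,v^u), e_{j1} ↦ (·,v^b)
  newHead : NewE G → NewV (n G)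
  newHead (solid e) with isSplit G (tgt G e)
  ... | true  = if cycOf C e =ᶠ lab (tgt G e) then up (tgt G e) else bot (tgt G e)
  ... | false = old (tgt G e)
  newHead (dashed v _ true)  = up v
  newHead (dashed v _ false) = bot v

  inE : Fin (N C) → NewE G → Bool
  inE j (solid e)      = cycOf C e =ᶠ j
  inE j (dashed _ _ _) = false

  -- d ∈ D(C_j): d is the dashed arc at a split v on C_j whose head equals the
  -- head of the image of the arc of C_j entering v
  inD : Fin (N C) → NewE G → Bool
  inD j (solid _) = false
  inD j d@(dashed v _ _) =
    any (λ e → (cycOf C e =ᶠ j) ∧ (tgt G e =ᶠ v) ∧ (newHead d =ⱽ newHead (solid e)))
        (allFin (m G))

  inTour : Fin (N C) → NewE G → Bool
  inTour j x = inD j x ∨ any (λ i → not (i =ᶠ j) ∧ inE i x) (allFin (N C))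

  _∈ᵇ_ : Fin (N C) → Subset (N C) → Bool
  j ∈ᵇ P = lookup P j

  g : Subset (N C) → Subset (N C) → List (NewE G) → ℕ
  g F Q S = length (filterᵇ (λ j → (j ∈ᵇ F) ∧ not (j ∈ᵇ Q) ∧ any (inE j) S)
                            (allFin (N C)))

  z : Subset (N C) → Subset (N C) → ℕ → List (NewE G) → ℚ
  z F Q t S =
    if not (any isDashed S)
    then (+ (t + 2) ℤ.- + g F Q S) / suc (suc t)
    else (if any (λ i → (i ∈ᵇ F) ∧ not (i ∈ᵇ Q) ∧ all (inTour i) S) (allFin (N C))
          then + 1 / suc (suc t)
          else 0ℚ)

  indicator : Fin (N C) → List (NewE G) → ℚ
  indicator h S = if all (inTour h) S then + 1 / 1 else 0ℚ

module Submission where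

-- The identity is purely combinatorial: of the hypotheses it only uses that a
-- split vertex has indegree 2 and that the labelling names, at every split
-- vertex, one of the cycles entering it.  Since
--   (t+2)/(t+3) · x/(t+2) + 1/(t+3) · y/1 = (x+y)/(t+3)            (mix),
-- it suffices to write z^{Q∪{h},t}_S = x/(t+2) and 1[S ⊆ tour(h)] = y/1 and
-- to check that z^{Q,t+1}_S has numerator x + y.  Both g_Q(S) and the test
-- "S ⊆ tour(i) for some i ∈ F − Q" range over the indices available in F − Q,
-- and adding h to Q removes exactly the index h (count-insert, any-insert).
--   * S has no dashed arc: g_Q(S) = g_{Q∪{h}}(S) + 1[S meets E(C_h)], and a
--     solid S lies in tour(h) iff it misses E(C_h).
--   * S has a dashed arc: a dashed arc lies in tour(i) for at most one i
--     (tour-unique, the only place where indegree 2 is used), so S ⊆ tour(h)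
--     excludes every other witness i ∈ F − (Q ∪ {h}).

open import Defs
open import Data.Nat as ℕ using (ℕ; suc; _≤_; _+_; _<ᵇ_)
import Data.Nat.Properties as ℕP
open import Data.Fin as Fin using (Fin)
open import Data.Fin.Subset using (Subset; _∈_; _∉_; _⊆_; _∪_; ⁅_⁆; ∣_∣)
open import Data.Fin.Subset.Properties using (x∈p∪q⁺; x∈⁅x⁆; x∈⁅y⁆⇒x≡y)
open import Data.Vec using (lookup)
open import Data.Vec.Properties using (lookup-zipWith; []=⇒lookup; lookup⇒[]=)
open import Data.List using (List; []; _∷_; length; filterᵇ; allFin)
open import Data.List.Membership.Propositional using (find) renaming (_∈_ to _∈ₗ_)
open import Data.List.Membership.Propositional.Properties using (∈-allFin; ∈-filter⁺)
open import Data.List.Relation.Unary.All as All using (All; []; _∷_)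
open import Data.List.Relation.Unary.All.Properties using (all⁺)
open import Data.List.Relation.Unary.Any using (here; there; satisfied)
open import Data.List.Relation.Unary.Any.Properties using (any⁻)
open import Data.List.Relation.Unary.Unique.Propositional using (Unique; _∷_)
open import Data.List.Relation.Unary.Unique.Propositional.Properties using (allFin⁺)
open import Data.Bool using (Bool; true; false; not; _∧_; _∨_; T; if_then_else_)
open import Data.Bool.Properties using (T-≡; T-∧; ∧-zeroʳ; ∧-identityʳ; ∨-identityʳ)
open import Data.Bool.ListAction using (any; all)
open import Data.Integer as ℤ using (+_)
import Data.Integer.Properties as ℤP
open import Data.Integer.Tactic.RingSolver using (solve-∀)
open import Data.Rational using (ℚ; _/_; _*_; 0ℚ; fromℚᵘ) renaming (_+_ to _+ℚ_)
open import Data.Rational.Properties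
  using (toℚᵘ-injective; toℚᵘ-homo-+; toℚᵘ-homo-*; toℚᵘ-fromℚᵘ; fromℚᵘ-cong; 0/n≡0)
import Data.Rational.Unnormalised as ℚᵘ
import Data.Rational.Unnormalised.Properties as ℚᵘP
open import Data.Product using (Σ; _×_; _,_; proj₁)
open import Data.Sum using (_⊎_; inj₁; inj₂)
open import Data.Empty using (⊥; ⊥-elim)
open import Function using (Equivalence)
open import Relation.Nullary using (yes; no; contradiction)
open import Relation.Nullary.Decidable using (dec-true; dec-false)
open import Relation.Binary.PropositionalEquality

ι : Bool → ℕ
ι true  = 1
ι false = 0

=ᶠ-sound : ∀ {k} {i j : Fin k} → T (i =ᶠ j) → i ≡ j
=ᶠ-sound {i = i} {j} i=j with i Fin.≟ j
... | yes i≡j = i≡j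
... | no _    = ⊥-elim i=j

=ᶠ-complete : ∀ {k} {i j : Fin k} → i ≡ j → (i =ᶠ j) ≡ true
=ᶠ-complete {i = i} {j} = dec-true (i Fin.≟ j)

not-∨ : ∀ a b → not (a ∨ b) ≡ not a ∧ not b
not-∨ true  b = refl
not-∨ false b = refl

bool-cases : ∀ {P : Set} b → (b ≡ false → P) → (b ≡ true → P) → P
bool-cases false onFalse _      = onFalse refl
bool-cases true  _      onTrue = onTrue refl

module _ {A : Set} where

  length-filterᵇ-∷ : ∀ (p : A → Bool) x xs →
    length (filterᵇ p (x ∷ xs)) ≡ ι (p x) + length (filterᵇ p xs)
  length-filterᵇ-∷ p x xs with p x
  ... | true  = refl
  ... | false = refl

  length-filterᵇ-agree : ∀ {p q : A → Bool} {h} → (∀ x → x ≢ h → p x ≡ q x) →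
    ∀ {xs} → All (h ≢_) xs → length (filterᵇ p xs) ≡ length (filterᵇ q xs)
  length-filterᵇ-agree agree [] = refl
  length-filterᵇ-agree {p} {q} agree {x ∷ xs} (h≢x ∷ rest) = begin
    length (filterᵇ p (x ∷ xs))     ≡⟨ length-filterᵇ-∷ p x xs ⟩
    ι (p x) + length (filterᵇ p xs) ≡⟨ cong₂ _+_ (cong ι (agree x (≢-sym h≢x))) (length-filterᵇ-agree agree rest) ⟩
    ι (q x) + length (filterᵇ q xs) ≡⟨ length-filterᵇ-∷ q x xs ⟨
    length (filterᵇ q (x ∷ xs))     ∎
    where open ≡-Reasoning

  count-remove : ∀ {p q : A → Bool} {h} → (∀ x → x ≢ h → p x ≡ q x) → q h ≡ false →
    ∀ {xs} → Unique xs → h ∈ₗ xs →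
    length (filterᵇ p xs) ≡ ι (p h) + length (filterᵇ q xs)
  count-remove {p} {q} {h} agree qh {_ ∷ xs} (h∉xs ∷ _) (here refl) = begin
    length (filterᵇ p (h ∷ xs))                   ≡⟨ length-filterᵇ-∷ p h xs ⟩
    ι (p h) + length (filterᵇ p xs)               ≡⟨ cong (_+_ (ι (p h))) (length-filterᵇ-agree agree h∉xs) ⟩
    ι (p h) + length (filterᵇ q xs)               ≡⟨ cong (λ b → ι (p h) + (ι b + length (filterᵇ q xs))) qh ⟨
    ι (p h) + (ι (q h) + length (filterᵇ q xs))   ≡⟨ cong (_+_ (ι (p h))) (length-filterᵇ-∷ q h xs) ⟨
    ι (p h) + length (filterᵇ q (h ∷ xs))         ∎
    where open ≡-Reasoning
  count-remove {p} {q} {h} agree qh {x ∷ xs} (x∉xs ∷ uniq) (there h∈xs) = begin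
    length (filterᵇ p (x ∷ xs))                   ≡⟨ length-filterᵇ-∷ p x xs ⟩
    ι (p x) + length (filterᵇ p xs)               ≡⟨ cong₂ _+_ (cong ι (agree x x≢h)) (count-remove agree qh uniq h∈xs) ⟩
    ι (q x) + (ι (p h) + length (filterᵇ q xs))   ≡⟨ ℕP.+-assoc (ι (q x)) _ _ ⟨
    (ι (q x) + ι (p h)) + length (filterᵇ q xs)   ≡⟨ cong (_+ length (filterᵇ q xs)) (ℕP.+-comm (ι (q x)) (ι (p h))) ⟩
    (ι (p h) + ι (q x)) + length (filterᵇ q xs)   ≡⟨ ℕP.+-assoc (ι (p h)) _ _ ⟩
    ι (p h) + (ι (q x) + length (filterᵇ q xs))   ≡⟨ cong (_+_ (ι (p h))) (length-filterᵇ-∷ q x xs) ⟨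
    ι (p h) + length (filterᵇ q (x ∷ xs))         ∎
    where
    open ≡-Reasoning
    x≢h : x ≢ h
    x≢h = All.lookup x∉xs h∈xs

  any≡0<count : ∀ (p : A → Bool) xs → any p xs ≡ (0 <ᵇ length (filterᵇ p xs))
  any≡0<count p [] = refl
  any≡0<count p (x ∷ xs) with p x
  ... | true  = refl
  ... | false = any≡0<count p xs

  any-remove : ∀ {p q : A → Bool} {h} → (∀ x → x ≢ h → p x ≡ q x) → q h ≡ false →
    ∀ {xs} → Unique xs → h ∈ₗ xs → any p xs ≡ p h ∨ any q xs
  any-remove {p} {q} {h} agree qh {xs} uniq h∈xs = begin
    any p xs                                          ≡⟨ any≡0<count p xs ⟩
    0 <ᵇ length (filterᵇ p xs)                        ≡⟨ cong (0 <ᵇ_) (count-remove agree qh uniq h∈xs) ⟩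
    0 <ᵇ (ι (p h) + length (filterᵇ q xs))            ≡⟨ positive-ι+ (p h) _ ⟩
    p h ∨ (0 <ᵇ length (filterᵇ q xs))                ≡⟨ cong (p h ∨_) (any≡0<count q xs) ⟨
    p h ∨ any q xs                                    ∎
    where
    open ≡-Reasoning
    positive-ι+ : ∀ b n → (0 <ᵇ (ι b + n)) ≡ b ∨ (0 <ᵇ n)
    positive-ι+ true  n = refl
    positive-ι+ false n = refl

  any-false : ∀ (p : A → Bool) xs → (∀ x → p x ≡ false) → any p xs ≡ false
  any-false p []       _     = refl
  any-false p (x ∷ xs) never rewrite never x = any-false p xs never

ι-∨-exclusive : ∀ a b → (T a → b ≡ false) → ι (a ∨ b) ≡ ι b + ι a
ι-∨-exclusive true  b excl rewrite excl _ = refl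
ι-∨-exclusive false b _    = sym (ℕP.+-identityʳ (ι b))

any-at : ∀ {k} (ψ : Fin k → Bool) c → any (λ i → ψ i ∧ (c =ᶠ i)) (allFin k) ≡ ψ c
any-at {k} ψ c = begin
  any (λ i → ψ i ∧ (c =ᶠ i)) (allFin k)          ≡⟨ any-remove elsewhere refl (allFin⁺ k) (∈-allFin c) ⟩
  ψ c ∧ (c =ᶠ c) ∨ any (λ _ → false) (allFin k)  ≡⟨ cong₂ _∨_ (cong (ψ c ∧_) (=ᶠ-complete {i = c} refl))
                                                            (any-false _ (allFin k) (λ _ → refl)) ⟩
  ψ c ∧ true ∨ false                            ≡⟨ ∨-identityʳ _ ⟩
  ψ c ∧ true                                    ≡⟨ ∧-identityʳ (ψ c) ⟩
  ψ c                                           ∎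
  where
  open ≡-Reasoning
  elsewhere : ∀ i → i ≢ c → ψ i ∧ (c =ᶠ i) ≡ false
  elsewhere i i≢c = trans (cong (ψ i ∧_) (dec-false (c Fin.≟ i) (≢-sym i≢c))) (∧-zeroʳ (ψ i))

pigeonhole-2 : ∀ {A : Set} (xs : List A) {x y z} → length xs ≡ 2 →
  x ∈ₗ xs → y ∈ₗ xs → z ∈ₗ xs → x ≡ y ⊎ x ≡ z ⊎ y ≡ z
pigeonhole-2 (a ∷ b ∷ []) _ (here refl)         (here refl)         _                   = inj₁ refl
pigeonhole-2 (a ∷ b ∷ []) _ (there (here refl)) (there (here refl)) _                   = inj₁ refl
pigeonhole-2 (a ∷ b ∷ []) _ (here refl)         (there (here refl)) (here refl)         = inj₂ (inj₁ refl)
pigeonhole-2 (a ∷ b ∷ []) _ (here refl)         (there (here refl)) (there (here refl)) = inj₂ (inj₂ refl)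
pigeonhole-2 (a ∷ b ∷ []) _ (there (here refl)) (here refl)         (here refl)         = inj₂ (inj₂ refl)
pigeonhole-2 (a ∷ b ∷ []) _ (there (here refl)) (here refl)         (there (here refl)) = inj₂ (inj₁ refl)

-- available F Q φ i: i ∈ F − Q and φ i holds.  Both g_Q(S) (a count) and the
-- test "S ⊆ tour(i) for some i ∈ F − Q" (a search) range over such i.
available : ∀ {k} → Subset k → Subset k → (Fin k → Bool) → Fin k → Bool
available F Q φ i = lookup F i ∧ not (lookup Q i) ∧ φ i

module _ {k} {F Q : Subset k} {h : Fin k} where

  ∉⇒lookup-false : h ∉ Q → lookup Q h ≡ false
  ∉⇒lookup-false h∉Q with lookup Q h in eq
  ... | true  = contradiction (lookup⇒[]= h Q eq) h∉Q
  ... | false = refl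

  insert-self : lookup (Q ∪ ⁅ h ⁆) h ≡ true
  insert-self = []=⇒lookup (x∈p∪q⁺ {p = Q} (inj₂ (x∈⁅x⁆ h)))

  insert-other : ∀ {i} → i ≢ h → lookup (Q ∪ ⁅ h ⁆) i ≡ lookup Q i
  insert-other {i} i≢h = begin
    lookup (Q ∪ ⁅ h ⁆) i         ≡⟨ lookup-zipWith _∨_ i Q ⁅ h ⁆ ⟩
    lookup Q i ∨ lookup ⁅ h ⁆ i  ≡⟨ cong (lookup Q i ∨_) i∉⁅h⁆ ⟩
    lookup Q i ∨ false           ≡⟨ ∨-identityʳ (lookup Q i) ⟩
    lookup Q i                   ∎
    where
    open ≡-Reasoning
    i∉⁅h⁆ : lookup ⁅ h ⁆ i ≡ false
    i∉⁅h⁆ with lookup ⁅ h ⁆ i in eq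
    ... | true  = contradiction (x∈⁅y⁆⇒x≡y h (lookup⇒[]= i ⁅ h ⁆ eq)) i≢h
    ... | false = refl

  available-insert-self : ∀ φ → available F (Q ∪ ⁅ h ⁆) φ h ≡ false
  available-insert-self φ rewrite insert-self = ∧-zeroʳ (lookup F h)

  available-insert-other : ∀ φ {i} → i ≢ h → available F (Q ∪ ⁅ h ⁆) φ i ≡ available F Q φ i
  available-insert-other φ {i} i≢h = cong (λ b → lookup F i ∧ not b ∧ φ i) (insert-other i≢h)

  available-fresh : h ∈ F → h ∉ Q → ∀ φ → available F Q φ h ≡ φ h
  available-fresh h∈F h∉Q φ rewrite []=⇒lookup h∈F | ∉⇒lookup-false h∉Q = refl

  count-insert : h ∈ F → h ∉ Q → ∀ φ →
    length (filterᵇ (available F Q φ) (allFin k))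
      ≡ ι (φ h) + length (filterᵇ (available F (Q ∪ ⁅ h ⁆) φ) (allFin k))
  count-insert h∈F h∉Q φ =
    trans (count-remove (λ i i≢h → sym (available-insert-other φ i≢h)) (available-insert-self φ)
                        (allFin⁺ k) (∈-allFin h))
          (cong (λ b → ι b + length (filterᵇ (available F (Q ∪ ⁅ h ⁆) φ) (allFin k)))
                (available-fresh h∈F h∉Q φ))

  any-insert : h ∈ F → h ∉ Q → ∀ φ →
    any (available F Q φ) (allFin k) ≡ φ h ∨ any (available F (Q ∪ ⁅ h ⁆) φ) (allFin k)
  any-insert h∈F h∉Q φ =
    trans (any-remove (λ i i≢h → sym (available-insert-other φ i≢h)) (available-insert-self φ)
                      (allFin⁺ k) (∈-allFin h))
          (cong (_∨ any (available F (Q ∪ ⁅ h ⁆) φ) (allFin k)) (available-fresh h∈F h∉Q φ))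

available-false : ∀ {k} {F Q : Subset k} {φ : Fin k → Bool} {i} → φ i ≡ false → available F Q φ i ≡ false
available-false {F = F} {Q} {i = i} φi rewrite φi =
  trans (cong (lookup F i ∧_) (∧-zeroʳ (not (lookup Q i)))) (∧-zeroʳ (lookup F i))

fromℚᵘ-+ : ∀ p q → fromℚᵘ (p ℚᵘ.+ q) ≡ fromℚᵘ p +ℚ fromℚᵘ q
fromℚᵘ-+ p q = toℚᵘ-injective (ℚᵘP.≃-trans (toℚᵘ-fromℚᵘ (p ℚᵘ.+ q)) (ℚᵘP.≃-sym (ℚᵘP.≃-trans
  (toℚᵘ-homo-+ (fromℚᵘ p) (fromℚᵘ q)) (ℚᵘP.+-cong (toℚᵘ-fromℚᵘ p) (toℚᵘ-fromℚᵘ q)))))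

fromℚᵘ-* : ∀ p q → fromℚᵘ (p ℚᵘ.* q) ≡ fromℚᵘ p * fromℚᵘ q
fromℚᵘ-* p q = toℚᵘ-injective (ℚᵘP.≃-trans (toℚᵘ-fromℚᵘ (p ℚᵘ.* q)) (ℚᵘP.≃-sym (ℚᵘP.≃-trans
  (toℚᵘ-homo-* (fromℚᵘ p) (fromℚᵘ q)) (ℚᵘP.*-cong (toℚᵘ-fromℚᵘ p) (toℚᵘ-fromℚᵘ q)))))

scaleᵘ : ∀ d x → (+ suc d ℚᵘ./ suc (suc d)) ℚᵘ.* (x ℚᵘ./ suc d) ℚᵘ.≃ x ℚᵘ./ suc (suc d)
scaleᵘ d x = ℚᵘP.≃-trans
  (ℚᵘP.≃-reflexive (ℚᵘP./-cong {+ suc d ℤ.* x} refl (ℕP.*-comm (suc (suc d)) (suc d))))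
  (ℚᵘP.*-cancelˡ-/ (suc d) {x} {suc (suc d)})

unitᵘ : ∀ d y → (+ 1 ℚᵘ./ suc d) ℚᵘ.* (y ℚᵘ./ 1) ℚᵘ.≃ y ℚᵘ./ suc d
unitᵘ d y = ℚᵘP.≃-reflexive (ℚᵘP./-cong (ℤP.*-identityˡ y) (ℕP.*-identityʳ (suc d)))

common-denominatorᵘ : ∀ d x y → (x ℚᵘ./ suc d) ℚᵘ.+ (y ℚᵘ./ suc d) ℚᵘ.≃ (x ℤ.+ y) ℚᵘ./ suc d
common-denominatorᵘ d x y = ℚᵘP.≃-trans
  (ℚᵘP.≃-reflexive (ℚᵘP./-cong {n₂ = (x ℤ.+ y) ℤ.* + suc d} (sym (ℤP.*-distribʳ-+ (+ suc d) x y)) refl))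
  (ℚᵘP.*-cancelʳ-/ (suc d) {x ℤ.+ y} {suc d})

mix : ∀ t x y →
  (+ (t + 2) / suc (suc (suc t))) * (x / suc (suc t)) +ℚ (+ 1 / suc (suc (suc t))) * (y / 1)
    ≡ (x ℤ.+ y) / suc (suc (suc t))
mix t x y = begin
  (+ (t + 2) / t+3) * (x / suc (suc t)) +ℚ (+ 1 / t+3) * (y / 1)
    ≡⟨ cong (λ k → (+ k / t+3) * (x / suc (suc t)) +ℚ (+ 1 / t+3) * (y / 1)) (ℕP.+-comm t 2) ⟩
  fromℚᵘ a * fromℚᵘ b +ℚ fromℚᵘ c * fromℚᵘ e
    ≡⟨ cong₂ _+ℚ_ (fromℚᵘ-* a b) (fromℚᵘ-* c e) ⟨
  fromℚᵘ (a ℚᵘ.* b) +ℚ fromℚᵘ (c ℚᵘ.* e)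
    ≡⟨ fromℚᵘ-+ (a ℚᵘ.* b) (c ℚᵘ.* e) ⟨
  fromℚᵘ (a ℚᵘ.* b ℚᵘ.+ c ℚᵘ.* e)
    ≡⟨ fromℚᵘ-cong (ℚᵘP.≃-trans (ℚᵘP.+-cong (scaleᵘ (suc t) x) (unitᵘ (suc (suc t)) y))
                                 (common-denominatorᵘ (suc (suc t)) x y)) ⟩
  (x ℤ.+ y) / t+3 ∎
  where
  open ≡-Reasoning
  t+3 : ℕ
  t+3 = suc (suc (suc t))
  a b c e : ℚᵘ.ℚᵘ
  a = + suc (suc t) ℚᵘ./ t+3
  b = x ℚᵘ./ suc (suc t)
  c = + 1 ℚᵘ./ t+3
  e = y ℚᵘ./ 1

if-as-fraction : ∀ b d → (if b then + 1 / suc d else 0ℚ) ≡ + ι b / suc d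
if-as-fraction true  d = refl
if-as-fraction false d = sym (0/n≡0 (suc d))

solid-numerator : ∀ n m b → + suc n ℤ.- + (ι b + m) ≡ (+ n ℤ.- + m) ℤ.+ + ι (not b)
solid-numerator n m true  = shift (+ n) (+ m)
  where
  shift : ∀ a c → (+ 1 ℤ.+ a) ℤ.- (+ 1 ℤ.+ c) ≡ (a ℤ.- c) ℤ.+ + 0
  shift = solve-∀
solid-numerator n m false = shift (+ n) (+ m)
  where
  shift : ∀ a c → (+ 1 ℤ.+ a) ℤ.- c ≡ (a ℤ.- c) ℤ.+ + 1
  shift = solve-∀

mixture : ∀ t {a b c : ℚ} x y → b ≡ x / suc (suc t) → c ≡ y / 1 →
  a ≡ (x ℤ.+ y) / suc (suc (suc t)) →
  a ≡ (+ (t + 2) / suc (suc (suc t))) * b +ℚ (+ 1 / suc (suc (suc t))) * c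
mixture t x y b≡ c≡ a≡ = trans a≡ (trans (sym (mix t x y))
  (cong₂ (λ b c → (+ (t + 2) / suc (suc (suc t))) * b +ℚ (+ 1 / suc (suc (suc t))) * c) (sym b≡) (sym c≡)))

module TourUniqueness {G : Digraph} (C : CycleFamily G) (lab : Fin (n G) → Fin (N C))
                      (valid : ValidLabelling C lab) where
  open Split C lab

  at-most-two-cycles : ∀ {v} → T (isSplit G v) → (e₁ e₂ e₃ : Fin (m G)) →
    tgt G e₁ ≡ v → tgt G e₂ ≡ v → tgt G e₃ ≡ v →
    cycOf C e₁ ≢ cycOf C e₂ → cycOf C e₁ ≢ cycOf C e₃ → cycOf C e₂ ≢ cycOf C e₃ → ⊥
  at-most-two-cycles {v} split e₁ e₂ e₃ t₁ t₂ t₃ n₁₂ n₁₃ n₂₃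
    with pigeonhole-2 entering indeg≡2 (enters t₁) (enters t₂) (enters t₃)
    where
    entering : List (Fin (m G))
    entering = filterᵇ (λ e → tgt G e =ᶠ v) (allFin (m G))
    indeg≡2 : length entering ≡ 2
    indeg≡2 = ℕP.≡ᵇ⇒≡ (indeg G v) 2 (Equivalence.to T-∧ split .proj₁)
    enters : ∀ {e} → tgt G e ≡ v → e ∈ₗ entering
    enters {e} tₑ = ∈-filter⁺ _ (∈-allFin e) (Equivalence.from T-≡ (=ᶠ-complete tₑ))
  ... | inj₁ p        = n₁₂ (cong (cycOf C) p)
  ... | inj₂ (inj₁ p) = n₁₃ (cong (cycOf C) p)
  ... | inj₂ (inj₂ p) = n₂₃ (cong (cycOf C) p)

  head-entering : ∀ {e v} → tgt G e ≡ v → T (isSplit G v) →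
    newHead (solid e) ≡ (if cycOf C e =ᶠ lab v then up v else bot v)
  head-entering {e} refl split with isSplit G (tgt G e)
  ... | true  = refl
  ... | false = ⊥-elim split

  head-dashed : ∀ v split b → newHead (dashed v split b) ≡ (if b then up v else bot v)
  head-dashed v split true  = refl
  head-dashed v split false = refl

  up/bot-injective : ∀ (v : Fin (n G)) b c → T ((if b then up v else bot v) =ⱽ (if c then up v else bot v)) → b ≡ c
  up/bot-injective v true  true  _ = refl
  up/bot-injective v false false _ = refl

  inD-witness : ∀ i v split b → T (inD i (dashed v split b)) →
    Σ (Fin (m G)) λ e → cycOf C e ≡ i × tgt G e ≡ v × (cycOf C e =ᶠ lab v) ≡ b
  inD-witness i v split b inD-d
    with satisfied (any⁻ _ (allFin (m G)) inD-d)
  ... | e , on-e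
    with Equivalence.to T-∧ on-e
  ... | on-Cᵢ , rest
    with Equivalence.to T-∧ rest
  ... | enters , heads = e , =ᶠ-sound on-Cᵢ , tₑ , sym (up/bot-injective v b _ heads′)
    where
    tₑ : tgt G e ≡ v
    tₑ = =ᶠ-sound enters
    heads′ : T ((if b then up v else bot v) =ⱽ (if cycOf C e =ᶠ lab v then up v else bot v))
    heads′ = subst₂ (λ x y → T (x =ⱽ y)) (head-dashed v split b) (head-entering tₑ split) heads

  inTour-dashed : ∀ i v split b → inTour i (dashed v split b) ≡ inD i (dashed v split b)
  inTour-dashed i v split b =
    trans (cong (inD i (dashed v split b) ∨_) (any-false _ (allFin (N C)) (λ i′ → ∧-zeroʳ (not (i′ =ᶠ i)))))
          (∨-identityʳ _)

  -- At a split v exactly one cycle through v is lab v; the dashed arc into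
  -- v^u belongs to D(lab v) only, and the one into v^b to D of the other cycle
  -- only, since a third cycle entering v would violate indeg v = 2.
  tour-unique : ∀ {i j x} → T (isDashed x) → T (inTour i x) → T (inTour j x) → i ≡ j
  tour-unique {i} {j} {dashed v split b} _ x∈tourᵢ x∈tourⱼ
    with inD-witness i v split b (subst T (inTour-dashed i v split b) x∈tourᵢ)
       | inD-witness j v split b (subst T (inTour-dashed j v split b) x∈tourⱼ)
  ... | e , refl , tₑ , lₑ | e′ , refl , tₑ′ , lₑ′ with b
  ... | true  = trans (=ᶠ-sound (Equivalence.from T-≡ lₑ)) (sym (=ᶠ-sound (Equivalence.from T-≡ lₑ′)))
  ... | false with cycOf C e Fin.≟ cycOf C e′ | valid v split
  ...   | yes same | _ = same
  ...   | no differ | e₀ , t₀ , c₀ = ⊥-elim (at-most-two-cycles split e e′ e₀ tₑ tₑ′ t₀ differ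
                                       (λ p → not-lab lₑ (trans p c₀)) (λ p → not-lab lₑ′ (trans p c₀)))
    where
    not-lab : ∀ {c} → (c =ᶠ lab v) ≡ false → c ≢ lab v
    not-lab c≠ c≡ = contradiction (trans (sym (=ᶠ-complete c≡)) c≠) λ ()

module Recurrence {G : Digraph} (C : CycleFamily G) (lab : Fin (n G) → Fin (N C))
                  (valid : ValidLabelling C lab)
                  (F Q : Subset (N C)) (h : Fin (N C)) (h∈F : h ∈ F) (h∉Q : h ∉ Q)
                  (S : List (NewE G)) where
  open Split C lab
  open TourUniqueness C lab valid

  Q′ : Subset (N C)
  Q′ = Q ∪ ⁅ h ⁆

  inAllTour : Fin (N C) → Bool
  inAllTour i = all (inTour i) S

  z-by-shape : Subset (N C) → ℕ → Bool → ℚ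
  z-by-shape P t hasDashed =
    if not hasDashed
    then (+ (t + 2) ℤ.- + g F P S) / suc (suc t)
    else (if any (available F P inAllTour) (allFin (N C)) then + 1 / suc (suc t) else 0ℚ)

  z-solid : ∀ P t → any isDashed S ≡ false → z F P t S ≡ (+ (t + 2) ℤ.- + g F P S) / suc (suc t)
  z-solid P t noDashed = cong (z-by-shape P t) noDashed

  z-dashed : ∀ P t → any isDashed S ≡ true →
    z F P t S ≡ + ι (any (available F P inAllTour) (allFin (N C))) / suc (suc t)
  z-dashed P t someDashed = trans (cong (z-by-shape P t) someDashed) (if-as-fraction _ (suc t))

  indicator-fraction : indicator h S ≡ + ι (inAllTour h) / 1
  indicator-fraction = if-as-fraction (inAllTour h) 0

  inTour-solid : ∀ e → inTour h (solid e) ≡ not (cycOf C e =ᶠ h)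
  inTour-solid e = any-at (λ i → not (i =ᶠ h)) (cycOf C e)

  all-tour-solid : ∀ S′ → any isDashed S′ ≡ false → all (inTour h) S′ ≡ not (any (inE h) S′)
  all-tour-solid [] _ = refl
  all-tour-solid (solid e ∷ S′) noDashed = begin
    inTour h (solid e) ∧ all (inTour h) S′          ≡⟨ cong₂ _∧_ (inTour-solid e) (all-tour-solid S′ noDashed) ⟩
    not (cycOf C e =ᶠ h) ∧ not (any (inE h) S′)     ≡⟨ not-∨ (cycOf C e =ᶠ h) _ ⟨
    not ((cycOf C e =ᶠ h) ∨ any (inE h) S′)         ∎
    where open ≡-Reasoning

  z-step-solid : ∀ t → any isDashed S ≡ false →
    z F Q (suc t) S ≡ ((+ (t + 2) ℤ.- + g F Q′ S) ℤ.+ + ι (inAllTour h)) / suc (suc (suc t))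
  z-step-solid t noDashed = begin
    z F Q (suc t) S
      ≡⟨ z-solid Q (suc t) noDashed ⟩
    (+ suc (t + 2) ℤ.- + g F Q S) / t+3
      ≡⟨ cong (λ c → (+ suc (t + 2) ℤ.- + c) / t+3) (count-insert h∈F h∉Q (λ i → any (inE i) S)) ⟩
    (+ suc (t + 2) ℤ.- + (ι meets + g F Q′ S)) / t+3
      ≡⟨ cong (_/ t+3) (solid-numerator (t + 2) (g F Q′ S) meets) ⟩
    ((+ (t + 2) ℤ.- + g F Q′ S) ℤ.+ + ι (not meets)) / t+3
      ≡⟨ cong (λ c → ((+ (t + 2) ℤ.- + g F Q′ S) ℤ.+ + ι c) / t+3) (all-tour-solid S noDashed) ⟨
    ((+ (t + 2) ℤ.- + g F Q′ S) ℤ.+ + ι (inAllTour h)) / t+3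
      ∎
    where
    open ≡-Reasoning
    t+3 : ℕ
    t+3 = suc (suc (suc t))
    meets : Bool
    meets = any (inE h) S

  other-tours-miss : T (inAllTour h) → ∀ {x} → x ∈ₗ S → T (isDashed x) → ∀ i → i ≢ h → inAllTour i ≡ false
  other-tours-miss S⊆tourₕ x∈S x-dashed i i≢h with inAllTour i in S⊆tourᵢ
  ... | false = refl
  ... | true  = contradiction (tour-unique x-dashed (All.lookup (all⁺ _ S (Equivalence.from T-≡ S⊆tourᵢ)) x∈S)
                                                 (All.lookup (all⁺ _ S S⊆tourₕ) x∈S)) i≢h

  z-step-dashed : ∀ t → any isDashed S ≡ true →
    z F Q (suc t) S ≡ (+ ι (any (available F Q′ inAllTour) (allFin (N C))) ℤ.+ + ι (inAllTour h)) / suc (suc (suc t))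
  z-step-dashed t someDashed with find (any⁻ isDashed S (Equivalence.from T-≡ someDashed))
  ... | x , x∈S , x-dashed = trans (z-dashed Q (suc t) someDashed)
          (cong (λ k → + k / suc (suc (suc t)))
                (trans (cong ι (any-insert h∈F h∉Q inAllTour))
                       (ι-∨-exclusive (inAllTour h) _ none-after-h)))
    where
    none-after-h : T (inAllTour h) → any (available F Q′ inAllTour) (allFin (N C)) ≡ false
    none-after-h S⊆tourₕ = any-false _ (allFin (N C)) unavailable
      where
      unavailable : ∀ i → available F Q′ inAllTour i ≡ false
      unavailable i with i Fin.≟ h
      ... | yes refl = available-insert-self {F = F} {Q = Q} inAllTour
      ... | no i≢h   = available-false {F = F} {Q = Q′} {φ = inAllTour} (other-tours-miss S⊆tourₕ x∈S x-dashed i i≢h)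

-- Lemma 8.  Only h ∈ F − Q, the labelling, and indeg v = 2 at split
-- vertices (inside isSplit) are used.
lemma8 : (G : Digraph) → Simple G → StronglyConnected G
    → (∀ v → indeg G v ≤ 2) → (∀ v → outdeg G v ≤ 2)
    → (C : CycleFamily G) (F : Subset (N C)) → IsGoodDecomposition C F
    → (lab : Fin (n G) → Fin (N C)) → ValidLabelling C lab
    → (t : ℕ) (S : List (NewE G)) → Unique S → length S ≤ suc t
    → (Q : Subset (N C)) → Q ⊆ F → ∣ Q ∣ + (t + 3) ≤ ∣ F ∣
    → (h : Fin (N C)) → h ∈ F → h ∉ Q
    → Split.z C lab F Q (suc t) S
      ≡ ((+ (t + 2) / suc (suc (suc t))) * Split.z C lab F (Q ∪ ⁅ h ⁆) t S)
        +ℚ ((+ 1 / suc (suc (suc t))) * Split.indicator C lab h S)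
lemma8 G _ _ _ _ C F _ lab valid t S _ _ Q _ _ h h∈F h∉Q =
  bool-cases (any isDashed S)
    (λ solidS → mixture t (+ (t + 2) ℤ.- + g F Q′ S) (+ ι (inAllTour h))
                  (z-solid Q′ t solidS) indicator-fraction (z-step-solid t solidS))
    (λ dashedS → mixture t (+ ι (any (available F Q′ inAllTour) (allFin (N C)))) (+ ι (inAllTour h))
                   (z-dashed Q′ t dashedS) indicator-fraction (z-step-dashed t dashedS))
  where
  open Split C lab
  open Recurrence C lab valid F Q h h∈F h∉Q S
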